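{- Fix an integer $t>1$ and let $x$ be a word in the letters $t$ and $\bar t$. Then $u_x-u_{[x]}\in J_{\mathcal B}$, where \[ [x]=t^{\,w_t(x)+\alpha_t(x)}\;\bar t^{\,\alpha_{t-1}(x)+\alpha_t(x)}\;t^{\,\alpha_{t-1}(x)}. \]
   Context: $\mathcal U$ is the free associative $\mathbf C$-algebra on generators $u_i$ and $d_i=u_{\bar i}$ ($i\ge1$); for a word $x=x_1\cdots x_\ell$, $u_x=u_{x_1}\cdots u_{x_\ell}$, and $a^k$ denotes the letter $a$ repeated $k$ times. $\mathcal B$ is the subalgebra generated by $u_t,d_t$, and $J_{\mathcal B}$ is the two-sided ideal of $\mathcal B$ generated by $u_t^{i+1}d_t^{i}-u_t^{i+1}d_t^{i+1}u_t$ and $u_t^{i}d_t^{i+1}-d_tu_t^{i+1}d_t^{i+1}$ for all integers $i\ge0$ (with $u_t^0=d_t^0=1$). For a word $x$, $w_i(x)$ = (number of occurrences of $i$) $-$ (number of occurrences of $\bar i$), and $\alpha_i(x)=\max\{w_{i+1}(\tilde x)-w_i(\tilde x)\}$ over all suffixes $\tilde x=x_j\cdots x_\ell$, $1\le j\le\ell+1$, including the empty suffix. (All exponents in $[x]$ are nonnegative.) -}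

module Defs where

open import Level using (Level)
open import Data.Nat as ℕ using (ℕ; zero; suc; _∸_)
open import Data.Bool using (Bool; true; false; if_then_else_)
open import Data.Integer as ℤ using (ℤ; +_; ∣_∣)
open import Data.List using (List; []; _∷_; _++_; replicate)
open import Data.List.Relation.Unary.All using (All)
open import Data.Product using (_×_; _,_; proj₂)
open import Data.Sum using (_⊎_)
open import Relation.Nullary using (Dec; yes; no; does)
open import Relation.Binary.PropositionalEquality using (_≡_; refl; cong)
open import Algebra.Bundles using (CommutativeRing)

-- Letters and words.  `u i` is the letter i, `d i` is the letter ī.

data Letter : Set where
  u : ℕ → Letter
  d : ℕ → Letter

_≟L_ : (a b : Letter) → Dec (a ≡ b)
u i ≟L u j with i ℕ.≟ j
... | yes refl = yes refl
... | no ne = no λ { refl → ne refl }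
u i ≟L d j = no λ ()
d i ≟L u j = no λ ()
d i ≟L d j with i ℕ.≟ j
... | yes refl = yes refl
... | no ne = no λ { refl → ne refl }

Word : Set
Word = List Letter

_≟W_ : (v w : Word) → Dec (v ≡ w)
[] ≟W [] = yes refl
[] ≟W (_ ∷ _) = no λ ()
(_ ∷ _) ≟W [] = no λ ()
(a ∷ v) ≟W (b ∷ w) with a ≟L b | v ≟W w
... | yes refl | yes refl = yes refl
... | no ne | _ = no λ { refl → ne refl }
... | yes _ | no ne = no λ { refl → ne refl }

occ : Letter → Word → ℕ
occ a [] = 0
occ a (b ∷ x) = (if does (b ≟L a) then 1 else 0) ℕ.+ occ a x

wt : ℕ → Word → ℤ
wt i x = + occ (u i) x ℤ.- + occ (d i) x

-- α_i(x) = max over all suffixes (including the empty one) of w_{i+1} − w_i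
α : ℕ → Word → ℤ
α i [] = wt (suc i) [] ℤ.- wt i []
α i (a ∷ x) = (wt (suc i) (a ∷ x) ℤ.- wt i (a ∷ x)) ℤ.⊔ α i x

IsT : ℕ → Letter → Set
IsT t a = (a ≡ u t) ⊎ (a ≡ d t)

-- [x] = t^{w_t+α_t} t̄^{α_{t-1}+α_t} t^{α_{t-1}}   (exponents are ≥ 0)
bracket : ℕ → Word → Word
bracket t x =
  replicate (∣ wt t x ℤ.+ α t x ∣) (u t)
  ++ replicate (∣ α (t ∸ 1) x ℤ.+ α t x ∣) (d t)
  ++ replicate (∣ α (t ∸ 1) x ∣) (u t)

-- The free associative R-algebra 𝒰 on the letters, as formal linear
-- combinations of words, compared coefficientwise.

module FreeAlg {c ℓ : Level} (R : CommutativeRing c ℓ) where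
  open CommutativeRing R renaming (_+_ to _+R_; _*_ to _*R_; -_ to -R_)

  U : Set c
  U = List (Carrier × Word)

  coeff : U → Word → Carrier
  coeff [] w = 0#
  coeff ((a , v) ∷ f) w = (if does (v ≟W w) then a else 0#) +R coeff f w

  _≈U_ : U → U → Set ℓ
  f ≈U g = ∀ w → coeff f w ≈ coeff g w

  zeroU : U
  zeroU = []

  _+U_ : U → U → U
  f +U g = f ++ g

  scaleMono : Carrier × Word → U → U
  scaleMono m [] = []
  scaleMono (a , v) ((b , w) ∷ g) = (a *R b , v ++ w) ∷ scaleMono (a , v) g

  _*U_ : U → U → U
  [] *U g = []
  (m ∷ f) *U g = scaleMono m g ++ (f *U g)

  mono : Word → U
  mono x = (1# , x) ∷ []

  _-U_ : U → U → U
  f -U g = f ++ scaleMono (-R 1# , []) g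

  -- ℬ: the subalgebra generated by u_t, d_t = span of words in t, t̄
  InB : ℕ → U → Set c
  InB t f = All (λ m → All (IsT t) (proj₂ m)) f

  genJ₁ genJ₂ : ℕ → ℕ → U
  genJ₁ t i = mono (replicate (suc i) (u t) ++ replicate i (d t))
              -U mono (replicate (suc i) (u t) ++ replicate (suc i) (d t) ++ (u t ∷ []))
  genJ₂ t i = mono (replicate i (u t) ++ replicate (suc i) (d t))
              -U mono (d t ∷ replicate (suc i) (u t) ++ replicate (suc i) (d t))

  data InJB (t : ℕ) : U → Set (c Level.⊔ ℓ) where
    gen₁  : ∀ i → InJB t (genJ₁ t i)
    gen₂  : ∀ i → InJB t (genJ₂ t i)
    zer   : InJB t zeroU
    add   : ∀ {f g} → InJB t f → InJB t g → InJB t (f +U g)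
    mulˡ  : ∀ {f} b → InB t b → InJB t f → InJB t (b *U f)
    mulʳ  : ∀ {f} b → InB t b → InJB t f → InJB t (f *U b)
    resp  : ∀ {f g} → f ≈U g → InJB t f → InJB t g

-- Every word in t, t̄ is J_ℬ-equivalent to a word t^p t̄^(p+k) t^r: prepending a letter
-- to such a word yields another one, either literally or after a single generator of
-- J_ℬ (t^(p+1) t̄^p ↦ t^(p+1) t̄^(p+1) t, resp. t̄ t^(p+1) t̄^(p+1) ↦ t^p t̄^(p+1)).
-- On words in t, t̄ the statistics satisfy α_t(a x) = max(−w_t(a x), α_t(x)) and
-- α_{t−1}(a x) = max(w_t(a x), α_{t−1}(x)); the values w_t = r − k, α_t = p + k − r,
-- α_{t−1} = r obey the same recursions along the rewriting, so the exponents of [x]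
-- are exactly p, p + k and r.
module Submission where

open import Defs
open import Data.Nat using (ℕ; _<_)
open import Data.List.Relation.Unary.All using (All)
open import Algebra.Bundles using (CommutativeRing)

open import Level using () renaming (_⊔_ to _⊔ˡ_)
open import Data.Bool using (Bool; true; false; if_then_else_)
open import Data.Nat as ℕ using (zero; suc; _+_)
open import Data.Nat.Properties using (1+n≢n; +-suc; m≤n+m; n≤1+n)
import Data.Nat.Properties as ℕₚ
open import Data.Integer as ℤ using (ℤ; +≤+; +_; _⊖_; _-_; -_; 0ℤ; 1ℤ; -1ℤ; _⊔_)
open import Data.Integer.Properties
  using ( [1+m]⊖[1+n]≡m⊖n; ⊖-swap; ⊖-monoˡ-≤; m⊖n≤m; +-cancelˡ-⊖; distribʳ-⊖-+-pos; distribʳ-⊖-+-neg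
        ; [+m]-[+n]≡m⊖n; pos-+; i≤j⇒i⊔j≡j; i≥j⇒i⊔j≡i)
import Data.Integer.Properties as ℤₚ
open import Data.Integer.Tactic.RingSolver using (solve-∀)
open import Data.List using ([]; _∷_; _++_; replicate; foldr)
open import Data.List.Properties using (++-assoc)
open import Data.List.Relation.Unary.All as All using ([]; _∷_)
open import Data.List.Relation.Unary.All.Properties using (++⁺; replicate⁺)
open import Data.Product using (_×_; _,_)
open import Data.Sum using (inj₁; inj₂)
open import Relation.Binary.Bundles using (Setoid)
open import Function using (_∘_)
open import Relation.Binary.PropositionalEquality
  using (_≡_; _≢_; refl; sym; trans; cong; cong₂; subst; module ≡-Reasoning)
open import Relation.Nullary using (does)
open import Relation.Nullary.Decidable using (dec-true; dec-false)
import Relation.Binary.Reasoning.Setoid as SetoidReasoning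
import Algebra.Properties.Ring as RingProperties

infixr 8 _^_

_^_ : Letter → ℕ → Word
a ^ n = replicate n a

^-+-++ : ∀ a m n (w : Word) → a ^ (m + n) ++ w ≡ a ^ m ++ a ^ n ++ w
^-+-++ a zero    n w = refl
^-+-++ a (suc m) n w = cong (a ∷_) (^-+-++ a m n w)

⊖-+-⊖ : ∀ p k r → (r ⊖ k) ℤ.+ ((p + k) ⊖ r) ≡ + p
⊖-+-⊖ p k r = begin
  (r ⊖ k) ℤ.+ ((p + k) ⊖ r)             ≡⟨ cong₂ ℤ._+_ ([+m]-[+n]≡m⊖n r k) ([+m]-[+n]≡m⊖n (p + k) r) ⟨
  (+ r - + k) ℤ.+ (+ (p + k) - + r)     ≡⟨ cong (λ q → (+ r - + k) ℤ.+ (q - + r)) (pos-+ p k) ⟩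
  (+ r - + k) ℤ.+ ((+ p ℤ.+ + k) - + r) ≡⟨ telescope (+ r) (+ k) (+ p) ⟩
  + p                                    ∎
  where
  open ≡-Reasoning
  telescope : ∀ r k p → (r - k) ℤ.+ ((p ℤ.+ k) - r) ≡ p
  telescope = solve-∀

+-⊖-cancel : ∀ r q → + r ℤ.+ (q ⊖ r) ≡ + q
+-⊖-cancel r q = begin
  + r ℤ.+ (q ⊖ r)    ≡⟨ distribʳ-⊖-+-pos r q r ⟩
  (r + q) ⊖ r        ≡⟨ cong ((r + q) ⊖_) (ℕₚ.+-identityʳ r) ⟨
  (r + q) ⊖ (r + 0)  ≡⟨ +-cancelˡ-⊖ r q 0 ⟩
  + q                ∎
  where open ≡-Reasoning

⊖-⊔-⊖ : ∀ {m n} o → m ℕ.≤ n → (m ⊖ o) ⊔ (n ⊖ o) ≡ n ⊖ o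
⊖-⊔-⊖ o m≤n = i≤j⇒i⊔j≡j (⊖-monoˡ-≤ o m≤n)

⊖-⊔-+ : ∀ m n → (m ⊖ n) ⊔ + m ≡ + m
⊖-⊔-+ m n = i≤j⇒i⊔j≡j (m⊖n≤m m n)

letter-weight : Letter → ℤ
letter-weight (u _) = 1ℤ
letter-weight (d _) = -1ℤ

occ-here : ∀ a x → occ a (a ∷ x) ≡ suc (occ a x)
occ-here a x rewrite dec-true (a ≟L a) refl = refl

occ-there : ∀ {a b} x → b ≢ a → occ a (b ∷ x) ≡ occ a x
occ-there {a} {b} x b≢a rewrite dec-false (b ≟L a) b≢a = refl

occ-absent : ∀ {a} x → All (_≢ a) x → occ a x ≡ 0
occ-absent []      []           = refl
occ-absent (_ ∷ x) (b≢a ∷ x≢a) = trans (occ-there x b≢a) (occ-absent x x≢a)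

wt-cons : ∀ {t a} x → IsT t a → wt t (a ∷ x) ≡ letter-weight a ℤ.+ wt t x
wt-cons {t} x (inj₁ refl)
  rewrite occ-here (u t) x =
  ℤₚ.+-assoc 1ℤ (+ occ (u t) x) (- + occ (d t) x)
wt-cons {t} x (inj₂ refl)
  rewrite occ-here (d t) x =
  shift (+ occ (u t) x) (+ occ (d t) x)
  where
  shift : ∀ m n → m - (1ℤ ℤ.+ n) ≡ - 1ℤ ℤ.+ (m - n)
  shift = solve-∀

wt-absent : ∀ {t j} x → j ≢ t → All (IsT t) x → wt j x ≡ 0ℤ
wt-absent {t} {j} x j≢t tx
  rewrite occ-absent {u j} x (All.map (λ { (inj₁ refl) refl → j≢t refl ; (inj₂ refl) () }) tx)
        | occ-absent {d j} x (All.map (λ { (inj₁ refl) () ; (inj₂ refl) refl → j≢t refl }) tx) =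
  refl

α-cons-above : ∀ {t a x} → All (IsT t) (a ∷ x) → α t (a ∷ x) ≡ - wt t (a ∷ x) ⊔ α t x
α-cons-above {t} {a} {x} tx = cong (_⊔ α t x) (begin
  wt (suc t) (a ∷ x) - wt t (a ∷ x)  ≡⟨ cong (_- wt t (a ∷ x)) (wt-absent (a ∷ x) 1+n≢n tx) ⟩
  0ℤ - wt t (a ∷ x)                  ≡⟨ ℤₚ.+-identityˡ _ ⟩
  - wt t (a ∷ x)                     ∎)
  where open ≡-Reasoning

α-cons-below : ∀ {s a x} → All (IsT (suc s)) (a ∷ x) → α s (a ∷ x) ≡ wt (suc s) (a ∷ x) ⊔ α s x
α-cons-below {s} {a} {x} tx = cong (_⊔ α s x) (begin
  wt (suc s) (a ∷ x) - wt s (a ∷ x)  ≡⟨ cong (λ w → wt (suc s) (a ∷ x) - w) (wt-absent (a ∷ x) (1+n≢n ∘ sym) tx) ⟩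
  wt (suc s) (a ∷ x) - 0ℤ            ≡⟨ ℤₚ.+-identityʳ _ ⟩
  wt (suc s) (a ∷ x)                 ∎)
  where open ≡-Reasoning

Shape : Set
Shape = ℕ × ℕ × ℕ

block : ℕ → Shape → Word
block t (p , k , r) = u t ^ p ++ d t ^ (p + k) ++ u t ^ r

-- Letter indices are ignored: shapes are only computed for words in t, t̄.
push : Letter → Shape → Shape
push (u _) (p , suc k , r) = suc p , k , r
push (u _) (p , zero  , r) = suc p , zero , suc r
push (d _) (zero  , k , r) = zero , suc k , r
push (d _) (suc p , k , r) = p , suc k , r

shape : Word → Shape
shape = foldr push (0 , 0 , 0)

-- w_t, α_t and α_{t−1} of block t σ
shape-wt shape-αt shape-αs : Shape → ℤ
shape-wt (p , k , r) = r ⊖ k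
shape-αt (p , k , r) = (p + k) ⊖ r
shape-αs (p , k , r) = + r

shape-wt-push : ∀ a σ → shape-wt (push a σ) ≡ letter-weight a ℤ.+ shape-wt σ
shape-wt-push (u _) (p , suc k , r) = sym (trans (distribʳ-⊖-+-pos 1 r (suc k)) ([1+m]⊖[1+n]≡m⊖n r k))
shape-wt-push (u _) (p , zero  , r) = sym (distribʳ-⊖-+-pos 1 r 0)
shape-wt-push (d _) (zero  , k , r) = sym (distribʳ-⊖-+-neg 0 r k)
shape-wt-push (d _) (suc p , k , r) = sym (distribʳ-⊖-+-neg 0 r k)

shape-αt-push : ∀ a σ → shape-αt (push a σ) ≡ - shape-wt (push a σ) ⊔ shape-αt σ
shape-αt-push (u _) (p , suc k , r) = begin
  (suc p + k) ⊖ r                ≡⟨ ⊖-⊔-⊖ r (m≤n+m k (suc p)) ⟨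
  (k ⊖ r) ⊔ ((suc p + k) ⊖ r)    ≡⟨ cong₂ _⊔_ (⊖-swap k r) (cong (_⊖ r) (sym (+-suc p k))) ⟩
  - (r ⊖ k) ⊔ ((p + suc k) ⊖ r)  ∎
  where open ≡-Reasoning
shape-αt-push (u _) (p , zero , r) = begin
  (suc p + 0) ⊖ suc r                       ≡⟨ ⊖-⊔-⊖ {0} {suc p + 0} (suc r) ℕ.z≤n ⟨
  (0 ⊖ suc r) ⊔ ((suc p + 0) ⊖ suc r)       ≡⟨ cong₂ _⊔_ (⊖-swap 0 (suc r)) ([1+m]⊖[1+n]≡m⊖n (p + 0) r) ⟩
  - (suc r ⊖ 0) ⊔ ((p + 0) ⊖ r)             ∎
  where open ≡-Reasoning
shape-αt-push (d _) (zero , k , r) = begin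
  suc k ⊖ r                 ≡⟨ i≥j⇒i⊔j≡i (⊖-monoˡ-≤ r (n≤1+n k)) ⟨
  (suc k ⊖ r) ⊔ (k ⊖ r)     ≡⟨ cong (_⊔ (k ⊖ r)) (⊖-swap (suc k) r) ⟩
  - (r ⊖ suc k) ⊔ (k ⊖ r)   ∎
  where open ≡-Reasoning
shape-αt-push (d _) (suc p , k , r) = begin
  (p + suc k) ⊖ r                    ≡⟨ ⊖-⊔-⊖ r (m≤n+m (suc k) p) ⟨
  (suc k ⊖ r) ⊔ ((p + suc k) ⊖ r)    ≡⟨ cong₂ _⊔_ (⊖-swap (suc k) r) (cong (_⊖ r) (+-suc p k)) ⟩
  - (r ⊖ suc k) ⊔ ((suc p + k) ⊖ r)  ∎
  where open ≡-Reasoning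

shape-αs-push : ∀ a σ → shape-αs (push a σ) ≡ shape-wt (push a σ) ⊔ shape-αs σ
shape-αs-push (u _) (p , suc k , r) = sym (⊖-⊔-+ r k)
shape-αs-push (u _) (p , zero  , r) = sym (i≥j⇒i⊔j≡i (+≤+ (n≤1+n r)))
shape-αs-push (d _) (zero  , k , r) = sym (⊖-⊔-+ r (suc k))
shape-αs-push (d _) (suc p , k , r) = sym (⊖-⊔-+ r (suc k))

wt-shape : ∀ {t x} → All (IsT t) x → wt t x ≡ shape-wt (shape x)
wt-shape []                = refl
wt-shape {t} {a ∷ x} (ta ∷ tx) = begin
  wt t (a ∷ x)                            ≡⟨ wt-cons x ta ⟩
  letter-weight a ℤ.+ wt t x              ≡⟨ cong (λ w → letter-weight a ℤ.+ w) (wt-shape tx) ⟩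
  letter-weight a ℤ.+ shape-wt (shape x)  ≡⟨ shape-wt-push a (shape x) ⟨
  shape-wt (shape (a ∷ x))                ∎
  where open ≡-Reasoning

αt-shape : ∀ {t x} → All (IsT t) x → α t x ≡ shape-αt (shape x)
αt-shape []                         = refl
αt-shape {t} {a ∷ x} tax@(_ ∷ tx) = begin
  α t (a ∷ x)                                      ≡⟨ α-cons-above tax ⟩
  - wt t (a ∷ x) ⊔ α t x                           ≡⟨ cong₂ (λ w β → - w ⊔ β) (wt-shape tax) (αt-shape tx) ⟩
  - shape-wt (shape (a ∷ x)) ⊔ shape-αt (shape x)  ≡⟨ shape-αt-push a (shape x) ⟨
  shape-αt (shape (a ∷ x))                         ∎
  where open ≡-Reasoning

αs-shape : ∀ {s x} → All (IsT (suc s)) x → α s x ≡ shape-αs (shape x)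
αs-shape []                         = refl
αs-shape {s} {a ∷ x} tax@(_ ∷ tx) = begin
  α s (a ∷ x)                                     ≡⟨ α-cons-below tax ⟩
  wt (suc s) (a ∷ x) ⊔ α s x                      ≡⟨ cong₂ _⊔_ (wt-shape tax) (αs-shape tx) ⟩
  shape-wt (shape (a ∷ x)) ⊔ shape-αs (shape x)   ≡⟨ shape-αs-push a (shape x) ⟨
  shape-αs (shape (a ∷ x))                        ∎
  where open ≡-Reasoning

bracket-shape : ∀ {s x} → All (IsT (suc s)) x → bracket (suc s) x ≡ block (suc s) (shape x)
bracket-shape {s} {x} tx
  rewrite wt-shape tx | αt-shape tx | αs-shape tx
  with shape x
... | p , k , r rewrite ⊖-+-⊖ p k r | +-⊖-cancel r (p + k) = refl

module JCongruence {c ℓ} (R : CommutativeRing c ℓ) (t : ℕ) where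
  open FreeAlg R
  open CommutativeRing R
    using (Carrier; _≈_; 0#; 1#; +-cong; +-congˡ; +-congʳ; +-assoc; +-comm; +-identityˡ; +-identityʳ
          ; *-identityˡ; *-identityʳ; -‿cong; -‿inverseˡ; setoid)
    renaming (_+_ to _+R_; _*_ to _*R_; -_ to -R_; refl to ≈-refl; sym to ≈-sym; trans to ≈-trans)
  open RingProperties (CommutativeRing.ring R) using (-1*x≈-x; -‿involutive)

  infix 4 _∼_

  _∼_ : Word → Word → Set (c ⊔ˡ ℓ)
  x ∼ y = InJB t (mono x -U mono y)

  -- the coefficient of y in mono x -U mono y, as _-U_ writes it
  -1# : Carrier
  -1# = -R 1# *R 1#

  indicator : Bool → Carrier → Carrier
  indicator b a = if b then a else 0#

  indicator-cong : ∀ b {a a′} → a ≈ a′ → indicator b a ≈ indicator b a′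
  indicator-cong true  a≈a′ = a≈a′
  indicator-cong false _    = ≈-refl

  indicator-inverse : ∀ b → indicator b -1# +R indicator b 1# ≈ 0#
  indicator-inverse true  = ≈-trans (+-congʳ (-1*x≈-x 1#)) (-‿inverseˡ 1#)
  indicator-inverse false = +-identityˡ 0#

  binomial-cong : ∀ {a a′ b b′ x y} → a ≈ a′ → b ≈ b′ →
                  ((a , x) ∷ (b , y) ∷ []) ≈U ((a′ , x) ∷ (b′ , y) ∷ [])
  binomial-cong a≈a′ b≈b′ w = +-cong (indicator-cong _ a≈a′) (+-congʳ (indicator-cong _ b≈b′))

  binomial-swap : ∀ {a b x y} → ((a , x) ∷ (b , y) ∷ []) ≈U ((b , y) ∷ (a , x) ∷ [])
  binomial-swap {a} {b} {x} {y} w = begin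
    A +R (B +R 0#)  ≈⟨ +-congˡ (+-identityʳ B) ⟩
    A +R B          ≈⟨ +-comm A B ⟩
    B +R A          ≈⟨ +-congˡ (+-identityʳ A) ⟨
    B +R (A +R 0#)  ∎
    where
    open SetoidReasoning setoid
    A = indicator (does (x ≟W w)) a
    B = indicator (does (y ≟W w)) b

  ∼-refl : ∀ {x} → x ∼ x
  ∼-refl {x} = resp (λ w → ≈-sym (annihilate (does (x ≟W w)))) zer
    where
    annihilate : ∀ b → indicator b 1# +R (indicator b -1# +R 0#) ≈ 0#
    annihilate b = ≈-trans (+-congˡ (+-identityʳ _)) (≈-trans (+-comm _ _) (indicator-inverse b))

  ∼-sym : ∀ {x y} → x ∼ y → y ∼ x
  ∼-sym {x} {y} x∼y =
    resp (λ w → ≈-trans (binomial-cong {x = x} {y = y} ≈-refl -1*-1≈1 w) (binomial-swap {x = x} {y = y} w))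
         (mulˡ ((-R 1# , []) ∷ []) ([] ∷ []) x∼y)
    where
    -1*-1≈1 : -R 1# *R -1# ≈ 1#
    -1*-1≈1 = ≈-trans (-1*x≈-x -1#) (≈-trans (-‿cong (-1*x≈-x 1#)) (-‿involutive 1#))

  ∼-trans : ∀ {x y z} → x ∼ y → y ∼ z → x ∼ z
  ∼-trans {x} {y} {z} x∼y y∼z = resp (λ w → +-congˡ (cancel (does (y ≟W w)) _)) (add x∼y y∼z)
    where
    cancel : ∀ b K → indicator b -1# +R (indicator b 1# +R K) ≈ K
    cancel b K = ≈-trans (≈-sym (+-assoc _ _ K)) (≈-trans (+-congʳ (indicator-inverse b)) (+-identityˡ K))

  ∼-congˡ : ∀ {x y} v → All (IsT t) v → x ∼ y → v ++ x ∼ v ++ y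
  ∼-congˡ {x} {y} v tv x∼y =
    resp (binomial-cong {x = v ++ x} {y = v ++ y} (*-identityˡ 1#) (*-identityˡ -1#))
         (mulˡ (mono v) (tv ∷ []) x∼y)

  ∼-congʳ : ∀ {x y} v → All (IsT t) v → x ∼ y → x ++ v ∼ y ++ v
  ∼-congʳ {x} {y} v tv x∼y =
    resp (binomial-cong {x = x ++ v} {y = y ++ v} (*-identityʳ 1#) (*-identityʳ -1#))
         (mulʳ (mono v) (tv ∷ []) x∼y)

  ∼-setoid : Setoid _ _
  ∼-setoid = record
    { Carrier       = Word
    ; _≈_           = _∼_
    ; isEquivalence = record { refl = ∼-refl ; sym = ∼-sym ; trans = ∼-trans }
    }

  open SetoidReasoning ∼-setoid

  ≡⇒∼ : ∀ {x y} → x ≡ y → x ∼ y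
  ≡⇒∼ refl = ∼-refl

  t-power : ∀ n → All (IsT t) (u t ^ n)
  t-power n = replicate⁺ n (inj₁ refl)

  t̄-power : ∀ n → All (IsT t) (d t ^ n)
  t̄-power n = replicate⁺ n (inj₂ refl)

  generator₁ : ∀ i {w} → All (IsT t) w →
               u t ^ suc i ++ d t ^ i ++ w ∼ u t ^ suc i ++ d t ^ suc i ++ u t ∷ w
  generator₁ i {w} tw = begin
    u t ^ suc i ++ d t ^ i ++ w                      ≡⟨ ++-assoc (u t ^ suc i) (d t ^ i) w ⟨
    (u t ^ suc i ++ d t ^ i) ++ w                    ≈⟨ ∼-congʳ w tw (gen₁ i) ⟩
    (u t ^ suc i ++ d t ^ suc i ++ u t ∷ []) ++ w    ≡⟨ ++-assoc (u t ^ suc i) (d t ^ suc i ++ u t ∷ []) w ⟩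
    u t ^ suc i ++ (d t ^ suc i ++ u t ∷ []) ++ w    ≡⟨ cong (u t ^ suc i ++_) (++-assoc (d t ^ suc i) (u t ∷ []) w) ⟩
    u t ^ suc i ++ d t ^ suc i ++ u t ∷ w            ∎

  generator₂ : ∀ i {w} → All (IsT t) w →
               u t ^ i ++ d t ^ suc i ++ w ∼ d t ∷ u t ^ suc i ++ d t ^ suc i ++ w
  generator₂ i {w} tw = begin
    u t ^ i ++ d t ^ suc i ++ w                      ≡⟨ ++-assoc (u t ^ i) (d t ^ suc i) w ⟨
    (u t ^ i ++ d t ^ suc i) ++ w                    ≈⟨ ∼-congʳ w tw (gen₂ i) ⟩
    (d t ∷ u t ^ suc i ++ d t ^ suc i) ++ w          ≡⟨ cong (d t ∷_) (++-assoc (u t ^ suc i) (d t ^ suc i) w) ⟩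
    d t ∷ u t ^ suc i ++ d t ^ suc i ++ w            ∎

  push-sound : ∀ {a} → IsT t a → ∀ σ → a ∷ block t σ ∼ block t (push a σ)
  push-sound (inj₁ refl) (p , suc k , r) = ≡⇒∼ (cong (λ n → u t ^ suc p ++ d t ^ n ++ u t ^ r) (+-suc p k))
  push-sound (inj₁ refl) (p , zero , r) = begin
    u t ^ suc p ++ d t ^ (p + 0) ++ u t ^ r            ≡⟨ cong (λ n → u t ^ suc p ++ d t ^ n ++ u t ^ r) (ℕₚ.+-identityʳ p) ⟩
    u t ^ suc p ++ d t ^ p ++ u t ^ r                  ≈⟨ generator₁ p (t-power r) ⟩
    u t ^ suc p ++ d t ^ suc p ++ u t ^ suc r          ≡⟨ cong (λ n → u t ^ suc p ++ d t ^ n ++ u t ^ suc r) (ℕₚ.+-identityʳ (suc p)) ⟨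
    u t ^ suc p ++ d t ^ (suc p + 0) ++ u t ^ suc r    ∎
  push-sound (inj₂ refl) (zero , k , r) = ∼-refl
  push-sound (inj₂ refl) (suc p , k , r) = begin
    d t ∷ u t ^ suc p ++ d t ^ (suc p + k) ++ u t ^ r      ≡⟨ cong (λ w → d t ∷ u t ^ suc p ++ w) (^-+-++ (d t) (suc p) k (u t ^ r)) ⟩
    d t ∷ u t ^ suc p ++ d t ^ suc p ++ d t ^ k ++ u t ^ r  ≈⟨ generator₂ p (++⁺ (t̄-power k) (t-power r)) ⟨
    u t ^ p ++ d t ^ suc p ++ d t ^ k ++ u t ^ r            ≡⟨ cong (u t ^ p ++_) (^-+-++ (d t) (suc p) k (u t ^ r)) ⟨
    u t ^ p ++ d t ^ (suc p + k) ++ u t ^ r                 ≡⟨ cong (λ n → u t ^ p ++ d t ^ n ++ u t ^ r) (+-suc p k) ⟨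
    u t ^ p ++ d t ^ (p + suc k) ++ u t ^ r                 ∎

  shape-sound : ∀ {x} → All (IsT t) x → x ∼ block t (shape x)
  shape-sound []                = ∼-refl
  shape-sound {a ∷ x} (ta ∷ tx) = begin
    a ∷ x                      ≈⟨ ∼-congˡ (a ∷ []) (ta ∷ []) (shape-sound tx) ⟩
    a ∷ block t (shape x)      ≈⟨ push-sound ta (shape x) ⟩
    block t (push a (shape x)) ∎

proposition4p8 : ∀ {c ℓ} (R : CommutativeRing c ℓ) (t : ℕ) → 1 < t →
    (x : Word) → All (IsT t) x →
    FreeAlg.InJB R t (FreeAlg._-U_ R (FreeAlg.mono R x) (FreeAlg.mono R (bracket t x)))
proposition4p8 R (suc s) _ x tx = subst (x ∼_) (sym (bracket-shape tx)) (shape-sound tx)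
  where open JCongruence R (suc s)
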